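{- Let $p\ge 1$, $n\ge 0$, write $n=kp+q$ with $0\le q<p$, and assume $q>0$. In the configuration graph $\mathcal G$ of the Game of Cards with $p$ players and $n$ cards, for every configuration $a$ and every dual configuration $b$ there is a directed path in $\mathcal G$ from $a$ to $b$.
   Context: Game of Cards: $p$ players sit in a cycle; indices are taken modulo $p$, so the right neighbor of player $i$ is player $i+1$ and the right neighbor of player $p$ is player $1$. A configuration is a vector $a=(a_1,\dots,a_p)$ of nonnegative integers with $\sum_i a_i=n$. A move at position $i$ is allowed in $a$ iff $a_i>a_{i+1}$ (with $a_{p+1}=a_1$); it replaces $a_i$ by $a_i-1$ and $a_{i+1}$ by $a_{i+1}+1$. The graph $\mathcal G$ has the configurations as vertices and an arc $a\to b$ whenever $b$ is obtained from $a$ by one move. A configuration is called dual if it lies on a directed cycle of positive length in $\mathcal G$. -}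

module Defs where

open import Data.Nat using (ℕ; zero; suc; _+_; _>_; _%_; NonZero)
open import Data.Nat.DivMod using (m%n<n)
open import Data.Fin using (Fin; zero; suc; toℕ; fromℕ<)
open import Data.Product using (_×_; Σ; ∃)
open import Relation.Binary.PropositionalEquality using (_≡_; _≢_)
open import Relation.Binary.Construct.Closure.ReflexiveTransitive using (Star)
open import Relation.Binary.Construct.Closure.Transitive using (TransClosure)

-- Players are indexed by Fin p (the paper's player i+1 is index i).
-- Cyclic right neighbour: i ↦ (i+1) mod p.
next : {p : ℕ} → .{{_ : NonZero p}} → Fin p → Fin p
next {p} i = fromℕ< (m%n<n (suc (toℕ i)) p)

total : {p : ℕ} → (Fin p → ℕ) → ℕ
total {zero} a = 0
total {suc p} a = a zero + total {p} (λ i → a (suc i))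

Config : (p n : ℕ) → Set
Config p n = Σ (Fin p → ℕ) (λ a → total a ≡ n)

record MoveAt {p n : ℕ} .{{_ : NonZero p}} (i : Fin p) (a b : Config p n) : Set where
  field
    allowed : Σ.proj₁ a i > Σ.proj₁ a (next i)
    dec     : suc (Σ.proj₁ b i) ≡ Σ.proj₁ a i
    inc     : Σ.proj₁ b (next i) ≡ suc (Σ.proj₁ a (next i))
    others  : ∀ j → j ≢ i → j ≢ next i → Σ.proj₁ b j ≡ Σ.proj₁ a j

_⟶_ : {p n : ℕ} .{{_ : NonZero p}} → Config p n → Config p n → Set
a ⟶ b = ∃ λ i → MoveAt i a b

Path : {p n : ℕ} .{{_ : NonZero p}} → Config p n → Config p n → Set
Path = Star _⟶_

Dual : {p n : ℕ} .{{_ : NonZero p}} → Config p n → Set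
Dual b = TransClosure _⟶_ b b

-- Write n = kp + q with 0 < q < p. Any configuration t with all entries in {k, k+1} is reachable
-- from any a: let f i be the number of cards that must still cross the edge i → i+1 to turn a
-- into t. While some f i is positive, some edge with f i > 0 admits a move, for otherwise the
-- edges that owe a card to a player holding at most k would be closed under stepping back around
-- the cycle, although they exist and do not exhaust the cycle (this is where 0 < q < p is used).
-- Conversely a dual b has all entries in {k, k+1}. Otherwise let low < high - 1 be its extreme
-- values; along moves the configurations stay within [low, high], the sum of squares never rises,
-- and when it stays put the move is a swap, which decreases the total forward distance from
-- high entries to low entries whenever a high entry advances or a low entry retreats. On a cycle
-- neither happens, so a position j₀ holding low keeps it and every move raises the moment
-- Σ_j dist(j₀, j) b_j, which is absurd. So a reaches a copy of b and then enters b's cycle.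

module Submission where

open import Defs
import Data.Nat as ℕ
open import Data.Nat
  using (ℕ; zero; suc; _+_; _*_; _∸_; _≤_; _<_; _>_; _%_; _/_; z≤n; s≤s; _≤?_; _<?_; _≟_)
open import Data.Nat.Properties
open import Data.Nat.DivMod using (m%n<n; n%n≡0; m<n⇒m%n≡m; m≡m%n+[m/n]*n)
open import Data.Nat.Tactic.RingSolver using (solve-∀)
open import Algebra.Properties.CommutativeSemigroup +-commutativeSemigroup
  using (interchange; xy∙z≈xz∙y; xy∙z≈zy∙x; x∙yz≈y∙zx; x∙yz≈zx∙y)
open import Algebra.Properties.CommutativeSemigroup *-commutativeSemigroup
  using () renaming (xy∙z≈xz∙y to *-xy∙z≈xz∙y)
open import Data.Fin using (Fin; zero; suc; toℕ; fromℕ; inject₁)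
import Data.Fin.Properties as Fin
open import Data.Fin.Induction using (<-weakInduction; <-weakInduction-startingFrom)
open import Data.Vec.Functional using (updateAt)
open import Data.Vec.Functional.Properties using (updateAt-updates; updateAt-minimal)
open import Data.Product using (∃; _×_; _,_; proj₁; proj₂)
open import Data.Sum using (_⊎_; inj₁; inj₂)
open import Data.Empty using (⊥-elim)
open import Relation.Nullary using (¬_; Dec; yes; no; ¬?; _×-dec_; decidable-stable)
open import Relation.Unary using (Decidable)
open import Relation.Binary.Definitions using (Transitive; Trans)
open import Data.Product.Relation.Binary.Lex.Strict using (×-Lex; ×-transitive)
import Relation.Binary.Construct.StrictToNonStrict as StrictToNonStrict
open import Relation.Binary.PropositionalEquality
open import Relation.Binary.Construct.Closure.ReflexiveTransitive using (Star; ε; _◅_; _◅◅_)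
open import Relation.Binary.Construct.Closure.Transitive using (TransClosure; [_]; _∷_)

total-cong : ∀ {p} {f g : Fin p → ℕ} → (∀ j → f j ≡ g j) → total f ≡ total g
total-cong {zero}  e = refl
total-cong {suc p} e = cong₂ _+_ (e zero) (total-cong (λ j → e (suc j)))

total-+ : ∀ {p} (f g : Fin p → ℕ) → total (λ j → f j + g j) ≡ total f + total g
total-+ {zero}  f g = refl
total-+ {suc p} f g = begin
  f zero + g zero + total (λ j → f (suc j) + g (suc j))
    ≡⟨ cong (f zero + g zero +_) (total-+ (λ j → f (suc j)) (λ j → g (suc j))) ⟩
  f zero + g zero + (total (λ j → f (suc j)) + total (λ j → g (suc j)))
    ≡⟨ interchange (f zero) (g zero) _ _ ⟩
  f zero + total (λ j → f (suc j)) + (g zero + total (λ j → g (suc j))) ∎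
  where open ≡-Reasoning

total-*ʳ : ∀ {p} (f : Fin p → ℕ) (c : ℕ) → total (λ j → f j * c) ≡ total f * c
total-*ʳ {zero}  f c = refl
total-*ʳ {suc p} f c = trans (cong (f zero * c +_) (total-*ʳ (λ j → f (suc j)) c))
                             (sym (*-distribʳ-+ c (f zero) _))

total-const : ∀ {p} (c : ℕ) → total {p} (λ _ → c) ≡ p * c
total-const {zero}  c = refl
total-const {suc p} c = cong (c +_) (total-const {p} c)

total-comm : ∀ {p q} (T : Fin p → Fin q → ℕ) →
             total (λ h → total (λ j → T h j)) ≡ total (λ j → total (λ h → T h j))
total-comm {zero}  {q} T = sym (trans (total-const {q} 0) (*-zeroʳ q))
total-comm {suc p}     T = trans (cong (total (T zero) +_) (total-comm (λ h → T (suc h))))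
                                 (sym (total-+ (T zero) (λ j → total (λ h → T (suc h) j))))

total-mono : ∀ {p} {f g : Fin p → ℕ} → (∀ j → f j ≤ g j) → total f ≤ total g
total-mono {zero}  le = z≤n
total-mono {suc p} le = +-mono-≤ (le zero) (total-mono (λ j → le (suc j)))

total-≤ : ∀ {p} {f : Fin p → ℕ} {c : ℕ} → (∀ j → f j ≤ c) → total f ≤ p * c
total-≤ {p} {c = c} le = ≤-trans (total-mono le) (≤-reflexive (total-const {p} c))

total-≥ : ∀ {p} {f : Fin p → ℕ} {c : ℕ} → (∀ j → c ≤ f j) → p * c ≤ total f
total-≥ {p} {c = c} le = ≤-trans (≤-reflexive (sym (total-const {p} c))) (total-mono le)

term≤total : ∀ {p} (f : Fin p → ℕ) (j : Fin p) → f j ≤ total f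
term≤total f zero    = m≤m+n _ _
term≤total f (suc j) = ≤-trans (term≤total (λ j → f (suc j)) j) (m≤n+m _ _)

total≡0⇒≡0 : ∀ {p} (f : Fin p → ℕ) → total f ≡ 0 → ∀ j → f j ≡ 0
total≡0⇒≡0 f e j = n≤0⇒n≡0 (subst (f j ≤_) e (term≤total f j))

total>0⇒>0 : ∀ {p} (f : Fin p → ℕ) → 0 < total f → ∃ λ j → 0 < f j
total>0⇒>0 {suc p} f pos with f zero in e
... | suc _ = zero , subst (0 <_) (sym e) (s≤s z≤n)
... | zero  with total>0⇒>0 (λ j → f (suc j)) pos
...   | j , fj>0 = suc j , fj>0

total-except₁ : ∀ {p} (f g : Fin p → ℕ) (i : Fin p) → (∀ j → j ≢ i → f j ≡ g j) →
                total f + g i ≡ total g + f i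
total-except₁ f g zero e =
  trans (cong (λ s → f zero + s + g zero) (total-cong (λ j → e (suc j) λ ())))
        (xy∙z≈zy∙x (f zero) _ (g zero))
total-except₁ f g (suc i) e =
  trans (+-assoc (f zero) _ (g (suc i)))
    (trans (cong₂ _+_ (e zero λ ())
                      (total-except₁ (λ j → f (suc j)) (λ j → g (suc j)) i
                                     (λ j j≢i → e (suc j) (λ eq → j≢i (Fin.suc-injective eq)))))
           (sym (+-assoc (g zero) _ (f (suc i)))))

total-except₂ : ∀ {p} (f g : Fin p → ℕ) {i i' : Fin p} → i ≢ i' →
                (∀ j → j ≢ i → j ≢ i' → f j ≡ g j) →
                total f + g i + g i' ≡ total g + f i + f i'
total-except₂ {p} f g {i} {i'} i≢i' e = begin
  total f + g i + g i'   ≡⟨ xy∙z≈xz∙y (total f) (g i) (g i') ⟩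
  total f + g i' + g i   ≡⟨ cong (_+ g i) f~h ⟩
  total h + f i' + g i   ≡⟨ xy∙z≈xz∙y (total h) (f i') (g i) ⟩
  total h + g i + f i'   ≡⟨ cong (_+ f i') h~g ⟩
  total g + h i + f i'   ≡⟨ cong (λ x → total g + x + f i') h-at-i ⟩
  total g + f i + f i'   ∎
  where
  open ≡-Reasoning
  h : Fin p → ℕ
  h = updateAt f i' (λ _ → g i')
  h-at-i : h i ≡ f i
  h-at-i = updateAt-minimal i i' f i≢i'
  f~h : total f + g i' ≡ total h + f i'
  f~h = trans (cong (total f +_) (sym (updateAt-updates i' f)))
              (total-except₁ f h i' (λ j j≢i' → sym (updateAt-minimal j i' f j≢i')))
  h~g : total h + g i ≡ total g + h i
  h~g = total-except₁ h g i h~g-off-i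
    where
    h~g-off-i : ∀ j → j ≢ i → h j ≡ g j
    h~g-off-i j j≢i with j Fin.≟ i'
    ... | yes refl = updateAt-updates j f
    ... | no j≢i'  = trans (updateAt-minimal j i' f j≢i') (e j j≢i j≢i')

suc-updateAt-pred : ∀ {p} (f : Fin p → ℕ) (i : Fin p) → 0 < f i → suc (updateAt f i ℕ.pred i) ≡ f i
suc-updateAt-pred f i f-i>0 = trans (cong suc (updateAt-updates i f)) (suc-pred (f i) {{ℕ.>-nonZero f-i>0}})

total-updateAt-pred : ∀ {p} (f : Fin p → ℕ) (i : Fin p) → 0 < f i →
                      suc (total (updateAt f i ℕ.pred)) ≡ total f
total-updateAt-pred {p} f i f-i>0 = +-cancelʳ-≡ (f' i) _ _ (begin
  suc (total f') + f' i   ≡⟨ sym (+-suc (total f') (f' i)) ⟩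
  total f' + suc (f' i)   ≡⟨ cong (total f' +_) (suc-updateAt-pred f i f-i>0) ⟩
  total f' + f i          ≡⟨ total-except₁ f' f i (λ j j≢i → updateAt-minimal j i f j≢i) ⟩
  total f + f' i          ∎)
  where
  open ≡-Reasoning
  f' : Fin p → ℕ
  f' = updateAt f i ℕ.pred

infix 8 _·_
_·_ : ∀ {p} → (Fin p → ℕ) → (Fin p → ℕ) → ℕ
w · u = total (λ j → w j * u j)

·-comm : ∀ {p} (w u : Fin p → ℕ) → w · u ≡ u · w
·-comm w u = total-cong (λ j → *-comm (w j) (u j))

record Transfer {p} (i i' : Fin p) (u u' : Fin p → ℕ) : Set where
  field
    distinct : i ≢ i'
    source   : suc (u' i) ≡ u i
    target   : u' i' ≡ suc (u i')
    others   : ∀ j → j ≢ i → j ≢ i' → u' j ≡ u j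

module _ {p} {i i' : Fin p} {u u' : Fin p → ℕ} (t : Transfer i i' u u') where
  open Transfer t

  transfer-· : (w : Fin p → ℕ) → w · u' + w i ≡ w · u + w i'
  transfer-· w = +-cancelʳ-≡ (w i * u' i + w i' * u i') _ _ (begin
    w · u' + w i + (w i * u' i + w i' * u i')  ≡⟨ shuffle (w · u') (w i) (w i') (u' i) (u i') ⟩
    w · u' + w i * suc (u' i) + w i' * u i'    ≡⟨ cong (λ x → w · u' + w i * x + w i' * u i') source ⟩
    w · u' + w i * u i + w i' * u i'           ≡⟨ total-except₂ (λ j → w j * u' j) (λ j → w j * u j) distinct
                                                    (λ j j≢i j≢i' → cong (w j *_) (others j j≢i j≢i')) ⟩
    w · u + w i * u' i + w i' * u' i'          ≡⟨ cong (λ x → w · u + w i * u' i + w i' * x) target ⟩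
    w · u + w i * u' i + w i' * suc (u i')     ≡⟨ sym (shuffle' (w · u) (w i) (w i') (u' i) (u i')) ⟩
    w · u + w i' + (w i * u' i + w i' * u i')  ∎)
    where
    open ≡-Reasoning
    shuffle : ∀ s x y a b → s + x + (x * a + y * b) ≡ s + x * suc a + y * b
    shuffle = solve-∀
    shuffle' : ∀ s x y a b → s + y + (x * a + y * b) ≡ s + x * a + y * suc b
    shuffle' = solve-∀

  transfer-sumSq : u' · u' + 2 * u' i ≡ u · u + 2 * u i'
  transfer-sumSq = +-cancelʳ-≡ (suc 0) _ _ (begin
    u' · u' + 2 * u' i + 1           ≡⟨ shuffle (u' · u') (u' i) ⟩
    u' · u' + u' i + suc (u' i)      ≡⟨ cong₂ _+_ (transfer-· u') source ⟩
    u' · u + u' i' + u i             ≡⟨ cong (λ x → x + u' i' + u i) (·-comm u' u) ⟩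
    u · u' + u' i' + u i             ≡⟨ xy∙z≈xz∙y (u · u') (u' i') (u i) ⟩
    u · u' + u i + u' i'             ≡⟨ cong₂ _+_ (transfer-· u) target ⟩
    u · u + u i' + suc (u i')        ≡⟨ sym (shuffle (u · u) (u i')) ⟩
    u · u + 2 * u i' + 1             ∎)
    where
    open ≡-Reasoning
    shuffle : ∀ s a → s + 2 * a + 1 ≡ s + a + suc a
    shuffle = solve-∀

record Exchange {p} (i i' : Fin p) (u u' : Fin p → ℕ) : Set where
  field
    distinct : i ≢ i'
    at-i     : u' i ≡ u i'
    at-i'    : u' i' ≡ u i
    others   : ∀ j → j ≢ i → j ≢ i' → u' j ≡ u j

module _ {p} {i i' : Fin p} {u u' : Fin p → ℕ} (x : Exchange i i' u u') where
  open Exchange x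

  exchange-map : (φ : ℕ → ℕ) → Exchange i i' (λ j → φ (u j)) (λ j → φ (u' j))
  exchange-map φ = record
    { distinct = distinct ; at-i = cong φ at-i ; at-i' = cong φ at-i'
    ; others = λ j j≢i j≢i' → cong φ (others j j≢i j≢i') }

  exchange-sym : Exchange i' i u u'
  exchange-sym = record
    { distinct = λ e → distinct (sym e) ; at-i = at-i' ; at-i' = at-i
    ; others = λ j j≢i' j≢i → others j j≢i j≢i' }

  exchange-fixes : u i ≡ u i' → ∀ j → u' j ≡ u j
  exchange-fixes u-i≡u-i' j with j Fin.≟ i | j Fin.≟ i'
  ... | yes refl | _        = trans at-i (sym u-i≡u-i')
  ... | no _     | yes refl = trans at-i' u-i≡u-i'
  ... | no j≢i   | no j≢i'  = others j j≢i j≢i'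

  exchange-transfer : u i ≡ 1 → u i' ≡ 0 → Transfer i i' u u'
  exchange-transfer u-i≡1 u-i'≡0 = record
    { distinct = distinct
    ; source = trans (cong suc (trans at-i u-i'≡0)) (sym u-i≡1)
    ; target = trans at-i' (trans u-i≡1 (cong suc (sym u-i'≡0)))
    ; others = others }

transfer-total : ∀ {p} {i i' : Fin p} {u u' : Fin p → ℕ} → Transfer i i' u u' → total u' ≡ total u
transfer-total {p} {u = u} {u'} t = +-cancelʳ-≡ 1 _ _ (begin
  total u' + 1                    ≡⟨ cong (_+ 1) (sym (ones· u')) ⟩
  (λ _ → 1) · u' + 1              ≡⟨ transfer-· t (λ _ → 1) ⟩
  (λ _ → 1) · u + 1               ≡⟨ cong (_+ 1) (ones· u) ⟩
  total u + 1                     ∎)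
  where
  open ≡-Reasoning
  ones· : (v : Fin p → ℕ) → (λ _ → 1) · v ≡ total v
  ones· v = total-cong (λ j → *-identityˡ (v j))

shift : ∀ {p} → (Fin p → ℕ) → Fin p → Fin p → Fin p → ℕ
shift u i i' = updateAt (updateAt u i ℕ.pred) i' suc

shift-transfer : ∀ {p} (u : Fin p → ℕ) {i i' : Fin p} → i ≢ i' → 0 < u i →
                 Transfer i i' u (shift u i i')
shift-transfer u {i} {i'} i≢i' u-i>0 = record
  { distinct = i≢i'
  ; source   = trans (cong suc (updateAt-minimal i i' _ i≢i')) (suc-updateAt-pred u i u-i>0)
  ; target   = trans (updateAt-updates i' _) (cong suc (updateAt-minimal i' i u (λ e → i≢i' (sym e))))
  ; others   = λ j j≢i j≢i' → trans (updateAt-minimal j i' _ j≢i') (updateAt-minimal j i u j≢i)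
  }

data LastView {m} : Fin (suc m) → Set where
  last   : LastView (fromℕ m)
  inject : (j : Fin m) → LastView (inject₁ j)

lastView : ∀ {m} (i : Fin (suc m)) → LastView i
lastView {zero}  zero    = last
lastView {suc m} zero    = inject zero
lastView {suc m} (suc i) with lastView i
... | last     = last
... | inject j = inject (suc j)

module _ {m : ℕ} where

  next-fromℕ : next (fromℕ m) ≡ zero
  next-fromℕ = Fin.toℕ-injective (begin
    toℕ (next (fromℕ m)) ≡⟨ Fin.toℕ-fromℕ< _ ⟩
    suc (toℕ (fromℕ m)) % suc m ≡⟨ cong (λ x → suc x % suc m) (Fin.toℕ-fromℕ m) ⟩
    suc m % suc m ≡⟨ n%n≡0 (suc m) ⟩
    0 ∎)
    where open ≡-Reasoning

  next-inject₁ : (j : Fin m) → next (inject₁ j) ≡ suc j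
  next-inject₁ j = Fin.toℕ-injective (begin
    toℕ (next (inject₁ j)) ≡⟨ Fin.toℕ-fromℕ< _ ⟩
    suc (toℕ (inject₁ j)) % suc m ≡⟨ cong (λ x → suc x % suc m) (Fin.toℕ-inject₁ j) ⟩
    suc (toℕ j) % suc m ≡⟨ m<n⇒m%n≡m (s≤s (Fin.toℕ<n j)) ⟩
    suc (toℕ j) ∎)
    where open ≡-Reasoning

  next-injective : {i j : Fin (suc m)} → next i ≡ next j → i ≡ j
  next-injective {i} {j} e with lastView i | lastView j
  ... | last     | last     = refl
  ... | last     | inject j' with () ← trans (sym next-fromℕ) (trans e (next-inject₁ j'))
  ... | inject i' | last    with () ← trans (sym next-fromℕ) (trans (sym e) (next-inject₁ i'))
  ... | inject i' | inject j' =
    cong inject₁ (Fin.suc-injective (trans (sym (next-inject₁ i')) (trans e (next-inject₁ j'))))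

  next-surjective : (j : Fin (suc m)) → ∃ λ i → next i ≡ j
  next-surjective zero    = fromℕ m , next-fromℕ
  next-surjective (suc j) = inject₁ j , next-inject₁ j

  ∃-next : {P : Fin (suc m) → Set} → ∃ P → ∃ λ i → P (next i)
  ∃-next {P} (j , P-j) = let i , next-i≡j = next-surjective j in i , subst P (sym next-i≡j) P-j

  cyclic-induction : (P : Fin (suc m) → Set) → (∀ i → P i → P (next i)) →
                     ∀ {i₀} → P i₀ → ∀ i → P i
  cyclic-induction P step {i₀} P-i₀ = <-weakInduction P P-zero up
    where
    up : ∀ j → P (inject₁ j) → P (suc j)
    up j P-j = subst P (next-inject₁ j) (step _ P-j)
    P-zero : P zero
    P-zero = subst P next-fromℕ (step _ (<-weakInduction-startingFrom P P-i₀ up (Fin.≤fromℕ i₀)))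

  boundary : {P : Fin (suc m) → Set} → Decidable P → ∀ {i₀ i₁} → P i₀ → ¬ P i₁ →
             ∃ λ i → P i × ¬ P (next i)
  boundary {P} P? {i₀} {i₁} P-i₀ ¬P-i₁ with Fin.any? (λ i → P? i ×-dec ¬? (P? (next i)))
  ... | yes found = found
  ... | no none   = ⊥-elim (¬P-i₁ (cyclic-induction P step P-i₀ i₁))
    where
    step : ∀ i → P i → P (next i)
    step i P-i = decidable-stable (P? (next i)) (λ ¬P-next-i → none (i , P-i , ¬P-next-i))

  private
    gap : ℕ → ℕ → ℕ
    gap a b with a ≤? b
    ... | yes _ = b ∸ a
    ... | no  _ = suc m + b ∸ a

    gap-sucʳ : ∀ {a b} → a ≤ m → b < m → a ≢ suc b → gap a (suc b) ≡ suc (gap a b)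
    gap-sucʳ {a} {b} a≤m b<m a≢1+b with a ≤? suc b | a ≤? b
    ... | yes _    | yes a≤b = +-∸-assoc 1 a≤b
    ... | yes a≤1+b | no a≰b = ⊥-elim (a≢1+b (≤-antisym a≤1+b (≰⇒> a≰b)))
    ... | no a≰1+b | yes a≤b = ⊥-elim (a≰1+b (m≤n⇒m≤1+n a≤b))
    ... | no _     | no _    = trans (cong (_∸ a) (+-suc (suc m) b))
                                     (+-∸-assoc 1 (≤-trans a≤m (≤-trans (n≤1+n m) (m≤m+n (suc m) b))))

    gap-wrapʳ : ∀ {a} → a ≤ m → 0 < a → gap a 0 ≡ suc (gap a m)
    gap-wrapʳ {a} a≤m a>0 with a ≤? 0 | a ≤? m
    ... | yes a≤0 | _       = ⊥-elim (<⇒≱ a>0 a≤0)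
    ... | no _    | yes _   = trans (cong (_∸ a) (+-identityʳ (suc m))) (+-∸-assoc 1 a≤m)
    ... | no _    | no a≰m  = ⊥-elim (a≰m a≤m)

    gap-sucˡ : ∀ {a b} → a < m → b ≤ m → b ≢ a → gap a b ≡ suc (gap (suc a) b)
    gap-sucˡ {a} {b} a<m b≤m b≢a with a ≤? b | suc a ≤? b
    ... | yes _   | yes a<b  = +-∸-assoc 1 a<b
    ... | yes a≤b | no a≮b   = ⊥-elim (b≢a (≤-antisym (≤-pred (≰⇒> a≮b)) a≤b))
    ... | no a≰b  | yes a<b  = ⊥-elim (a≰b (<⇒≤ a<b))
    ... | no _    | no _     = +-∸-assoc 1 (≤-trans a<m (≤-trans (n≤1+n m) (m≤m+n (suc m) b)))

    gap-wrapˡ : ∀ {b} → b ≤ m → b ≢ m → gap m b ≡ suc (gap 0 b)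
    gap-wrapˡ {b} b≤m b≢m with m ≤? b
    ... | yes m≤b = ⊥-elim (b≢m (≤-antisym b≤m m≤b))
    ... | no _    = trans (cong (_∸ m) (sym (+-suc m b))) (m+n∸m≡n m (suc b))

  dist : Fin (suc m) → Fin (suc m) → ℕ
  dist h j = gap (toℕ h) (toℕ j)

  dist-nextʳ : (h j : Fin (suc m)) → next j ≢ h → dist h (next j) ≡ suc (dist h j)
  dist-nextʳ h j next-j≢h with lastView j
  ... | last rewrite next-fromℕ | Fin.toℕ-fromℕ m =
    gap-wrapʳ (Fin.toℕ≤pred[n] h)
              (n≢0⇒n>0 λ h≡0 → next-j≢h (sym (Fin.toℕ-injective {j = zero} h≡0)))
  ... | inject j' rewrite next-inject₁ j' | Fin.toℕ-inject₁ j' =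
    gap-sucʳ (Fin.toℕ≤pred[n] h) (Fin.toℕ<n j') (λ e → next-j≢h (sym (Fin.toℕ-injective e)))

  dist-nextˡ : (h j : Fin (suc m)) → j ≢ h → dist h j ≡ suc (dist (next h) j)
  dist-nextˡ h j j≢h with lastView h
  ... | last rewrite next-fromℕ | Fin.toℕ-fromℕ m =
    gap-wrapˡ (Fin.toℕ≤pred[n] j) (λ e → j≢h (Fin.toℕ-injective (trans e (sym (Fin.toℕ-fromℕ m)))))
  ... | inject h' rewrite next-inject₁ h' | Fin.toℕ-inject₁ h' =
    gap-sucˡ (Fin.toℕ<n h') (Fin.toℕ≤pred[n] j)
             (λ e → j≢h (Fin.toℕ-injective (trans e (sym (Fin.toℕ-inject₁ h')))))

prefix : ∀ {m} → (Fin (suc m) → ℕ) → Fin (suc m) → ℕ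
prefix u zero            = u zero
prefix {suc m} u (suc j) = u zero + prefix (λ j → u (suc j)) j

prefix-suc : ∀ {m} (u : Fin (suc m) → ℕ) (j : Fin m) → prefix u (suc j) ≡ prefix u (inject₁ j) + u (suc j)
prefix-suc u zero    = refl
prefix-suc u (suc j) = trans (cong (u zero +_) (prefix-suc (λ j → u (suc j)) j)) (sym (+-assoc (u zero) _ _))

prefix-fromℕ : ∀ {m} (u : Fin (suc m) → ℕ) → prefix u (fromℕ m) ≡ total u
prefix-fromℕ {zero}  u = sym (+-identityʳ (u zero))
prefix-fromℕ {suc m} u = cong (u zero +_) (prefix-fromℕ (λ j → u (suc j)))

prefix≤total : ∀ {m} (u : Fin (suc m) → ℕ) (i : Fin (suc m)) → prefix u i ≤ total u
prefix≤total u zero            = m≤m+n (u zero) _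
prefix≤total {suc m} u (suc j) = +-monoʳ-≤ (u zero) (prefix≤total (λ j → u (suc j)) j)

uncons : ∀ {A : Set} {R : A → A → Set} {x y : A} → TransClosure R x y → ∃ λ z → R x z × Star R z y
uncons [ r ]      = _ , r , ε
uncons (r ∷ rest) = let _ , r' , rest' = uncons rest in _ , r , r' ◅ rest'

module _ {m n : ℕ} where
  private
    Cfg : Set
    Cfg = Config (suc m) n

  infix 4 _≈_
  _≈_ : Cfg → Cfg → Set
  a ≈ b = ∀ j → proj₁ a j ≡ proj₁ b j

  ⟶-respˡ-≈ : {a a' b : Cfg} → a ≈ a' → a ⟶ b → a' ⟶ b
  ⟶-respˡ-≈ a≈a' (i , mv) = i , record
    { allowed = subst₂ _>_ (a≈a' i) (a≈a' (next i)) allowed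
    ; dec     = trans dec (a≈a' i)
    ; inc     = trans inc (cong suc (a≈a' (next i)))
    ; others  = λ j j≢i j≢next-i → trans (others j j≢i j≢next-i) (a≈a' j)
    }
    where open MoveAt mv

  move⇒transfer : ∀ {i} {a b : Cfg} → MoveAt i a b → Transfer i (next i) (proj₁ a) (proj₁ b)
  move⇒transfer {a = a} mv = record
    { distinct = λ i≡next-i → <-irrefl (cong (proj₁ a) (sym i≡next-i)) allowed
    ; source = dec ; target = inc ; others = others }
    where open MoveAt mv

  swap⇒exchange : ∀ {i} {a b : Cfg} → MoveAt i a b → proj₁ b i ≡ proj₁ a (next i) →
                  Exchange i (next i) (proj₁ a) (proj₁ b)
  swap⇒exchange mv b-i≡a-next-i = record
    { distinct = Transfer.distinct (move⇒transfer mv)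
    ; at-i = b-i≡a-next-i
    ; at-i' = trans inc (trans (cong suc (sym b-i≡a-next-i)) dec)
    ; others = others }
    where open MoveAt mv

  private
    shift-next-transfer : (a : Cfg) (i : Fin (suc m)) → proj₁ a i > proj₁ a (next i) →
                          Transfer i (next i) (proj₁ a) (shift (proj₁ a) i (next i))
    shift-next-transfer a i gt =
      shift-transfer (proj₁ a) (λ e → <-irrefl (cong (proj₁ a) (sym e)) gt) (≤-trans (s≤s z≤n) gt)

  move : (a : Cfg) (i : Fin (suc m)) → proj₁ a i > proj₁ a (next i) → Cfg
  move a i gt = shift (proj₁ a) i (next i) , trans (transfer-total (shift-next-transfer a i gt)) (proj₂ a)

  move-arc : (a : Cfg) (i : Fin (suc m)) (gt : proj₁ a i > proj₁ a (next i)) → a ⟶ move a i gt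
  move-arc a i gt = i , record { allowed = gt ; dec = source ; inc = target ; others = others }
    where open Transfer (shift-next-transfer a i gt)

  -- f i is the number of cards that still have to pass from player i to player next i.
  Flow : Cfg → Cfg → (Fin (suc m) → ℕ) → Set
  Flow s t f = ∀ i → proj₁ s (next i) + f i ≡ proj₁ t (next i) + f (next i)

  flow-exists : (s t : Cfg) → ∃ (Flow s t)
  flow-exists (s , Σs) (t , Σt) = f , flow
    where
    f : Fin (suc m) → ℕ
    f i = n + prefix s i ∸ prefix t i
    f-spec : ∀ i → f i + prefix t i ≡ n + prefix s i
    f-spec i = m∸n+n≡m (≤-trans (subst (prefix t i ≤_) Σt (prefix≤total t i)) (m≤m+n n _))
    balance : ∀ {a b X Y A P} → X + A ≡ n + P → Y + (A + b) ≡ n + (P + a) → a + X ≡ b + Y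
    balance {a} {b} {X} {Y} {A} {P} X-spec Y-spec = +-cancelʳ-≡ A _ _ (begin
      a + X + A     ≡⟨ +-assoc a X A ⟩
      a + (X + A)   ≡⟨ cong (a +_) X-spec ⟩
      a + (n + P)   ≡⟨ x∙yz≈y∙zx a n P ⟩
      n + (P + a)   ≡⟨ sym Y-spec ⟩
      Y + (A + b)   ≡⟨ x∙yz≈zx∙y Y A b ⟩
      b + Y + A     ∎)
      where open ≡-Reasoning
    flow : Flow (s , Σs) (t , Σt) f
    flow i with lastView i
    ... | last rewrite next-fromℕ {m} =
      balance {b = t zero} {Y = f zero} {A = 0} {P = 0} (cong (_+ 0) f-last) (f-spec zero)
      where
      f-last : f (fromℕ m) ≡ n
      f-last = +-cancelˡ-≡ n _ _ (begin
        n + f (fromℕ m)                   ≡⟨ cong (_+ f (fromℕ m)) (sym (trans (prefix-fromℕ t) Σt)) ⟩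
        prefix t (fromℕ m) + f (fromℕ m)  ≡⟨ +-comm _ (f (fromℕ m)) ⟩
        f (fromℕ m) + prefix t (fromℕ m)  ≡⟨ f-spec (fromℕ m) ⟩
        n + prefix s (fromℕ m)            ≡⟨ cong (n +_) (trans (prefix-fromℕ s) Σs) ⟩
        n + n                             ∎)
        where open ≡-Reasoning
    ... | inject j rewrite next-inject₁ j =
      balance {b = t (suc j)} {Y = f (suc j)} (f-spec (inject₁ j))
              (trans (cong (f (suc j) +_) (sym (prefix-suc t j)))
                     (trans (f-spec (suc j)) (cong (n +_) (prefix-suc s j))))

  flow-done : ∀ {s t : Cfg} {f} → Flow s t f → total f ≡ 0 → s ≈ t
  flow-done {s} {t} {f} flow Σf≡0 j with next-surjective j
  ... | i , refl = +-cancelʳ-≡ 0 _ _ (subst₂ (λ x y → proj₁ s (next i) + x ≡ proj₁ t (next i) + y)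
                                              (f≡0 i) (f≡0 (next i)) (flow i))
    where
    f≡0 : ∀ j → f j ≡ 0
    f≡0 = total≡0⇒≡0 f Σf≡0

  flow-move : ∀ {s t : Cfg} {f} {i} (gt : proj₁ s i > proj₁ s (next i)) → Flow s t f → 0 < f i →
              Flow (move s i gt) t (updateAt f i ℕ.pred)
  flow-move {s} {t , _} {f} {i} gt flow f-i>0 = flow'
    where
    open Transfer (move⇒transfer (proj₂ (move-arc s i gt)))
    s' f' : Fin (suc m) → ℕ
    s' = proj₁ (move s i gt)
    f' = updateAt f i ℕ.pred
    f'-i : suc (f' i) ≡ f i
    f'-i = suc-updateAt-pred f i f-i>0
    f'-off : ∀ j → j ≢ i → f' j ≡ f j
    f'-off j j≢i = updateAt-minimal j i f j≢i
    open ≡-Reasoning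
    flow' : ∀ j → s' (next j) + f' j ≡ t (next j) + f' (next j)
    flow' j with j Fin.≟ i | next j Fin.≟ i
    ... | yes refl | _ = begin
      s' (next i) + f' i          ≡⟨ cong (_+ f' i) target ⟩
      suc (proj₁ s (next i)) + f' i ≡⟨ sym (+-suc (proj₁ s (next i)) (f' i)) ⟩
      proj₁ s (next i) + suc (f' i) ≡⟨ cong (proj₁ s (next i) +_) f'-i ⟩
      proj₁ s (next i) + f i        ≡⟨ flow i ⟩
      t (next i) + f (next i)     ≡⟨ cong (t (next i) +_) (sym (f'-off (next i) (λ e → distinct (sym e)))) ⟩
      t (next i) + f' (next i)    ∎
    ... | no j≢i | yes refl = suc-injective (begin
      suc (s' (next j) + f' j)    ≡⟨ cong (_+ f' j) source ⟩
      proj₁ s (next j) + f' j     ≡⟨ cong (proj₁ s (next j) +_) (f'-off j j≢i) ⟩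
      proj₁ s (next j) + f j      ≡⟨ flow j ⟩
      t (next j) + f (next j)     ≡⟨ cong (t (next j) +_) (sym f'-i) ⟩
      t (next j) + suc (f' (next j)) ≡⟨ +-suc (t (next j)) _ ⟩
      suc (t (next j) + f' (next j)) ∎)
    ... | no j≢i | no next-j≢i = begin
      s' (next j) + f' j          ≡⟨ cong₂ _+_ (others (next j) next-j≢i (λ e → j≢i (next-injective e)))
                                             (f'-off j j≢i) ⟩
      proj₁ s (next j) + f j      ≡⟨ flow j ⟩
      t (next j) + f (next j)     ≡⟨ cong (t (next j) +_) (sym (f'-off (next j) next-j≢i)) ⟩
      t (next j) + f' (next j)    ∎

module Balanced {m n k : ℕ} (above : suc m * k < n) (below : n < suc m * suc k) where
  private
    Cfg : Set
    Cfg = Config (suc m) n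

  some-above : (s : Cfg) → ∃ λ i → k < proj₁ s (next i)
  some-above (s , Σs) with Fin.any? (λ j → k <? s j)
  ... | yes found = ∃-next found
  ... | no none = ⊥-elim (<-irrefl Σs (≤-<-trans (total-≤ λ j → ≮⇒≥ λ k<s-j → none (j , k<s-j)) above))

  some-atMost : (s : Cfg) → ∃ λ i → proj₁ s (next i) ≤ k
  some-atMost (s , Σs) with Fin.any? (λ j → s j ≤? k)
  ... | yes found = ∃-next found
  ... | no none =
    ⊥-elim (<-irrefl (sym Σs) (<-≤-trans below (total-≥ λ j → ≰⇒> λ s-j≤k → none (j , s-j≤k))))

  module _ (t : Cfg) (t-balanced : ∀ j → k ≤ proj₁ t j × proj₁ t j ≤ suc k) where

    -- When no move is possible along an edge that still owes cards, "edge j owes a card although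
    -- next j holds at most k" propagates backwards around the cycle; it fails wherever a player
    -- holds more than k, yet it holds somewhere.
    module Stuck (s : Cfg) (f : Fin (suc m) → ℕ) (flow : Flow s t f)
                 (stuck : ∀ i → 0 < f i → proj₁ s i ≤ proj₁ s (next i)) where
      private
        sv tv : Fin (suc m) → ℕ
        sv = proj₁ s
        tv = proj₁ t

      Owed : Fin (suc m) → Set
      Owed j = 0 < f j × sv (next j) ≤ k

      owed-backward : ∀ j → Owed (next j) → Owed j
      owed-backward j (f-next-j>0 , next-next-j-low) = f-j>0 , next-j-low
        where
        next-j-low : sv (next j) ≤ k
        next-j-low = ≤-trans (stuck (next j) f-next-j>0) next-next-j-low
        f-j>0 : 0 < f j
        f-j>0 = ≮⇒≥ λ f-j<1 → <-irrefl refl (begin-strict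
          k                            ≤⟨ proj₁ (t-balanced (next j)) ⟩
          tv (next j)                  <⟨ m<m+n (tv (next j)) f-next-j>0 ⟩
          tv (next j) + f (next j)     ≡⟨ sym (flow j) ⟩
          sv (next j) + f j            ≡⟨ cong (sv (next j) +_) (n<1⇒n≡0 f-j<1) ⟩
          sv (next j) + 0              ≡⟨ +-identityʳ _ ⟩
          sv (next j)                  ≤⟨ next-j-low ⟩
          k                            ∎)
          where open ≤-Reasoning

      ¬owed : ∀ j → ¬ Owed j
      ¬owed = cyclic-induction (λ j → ¬ Owed j)
                               (λ j ¬owed-j owed-next-j → ¬owed-j (owed-backward j owed-next-j))
                               {proj₁ (some-above s)} (λ owed → <⇒≱ (proj₂ (some-above s)) (proj₂ owed))

      owed-somewhere : 0 < total f → ∃ Owed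
      owed-somewhere Σf>0 with Fin.any? (λ j → f j ≟ 0)
      ... | no f-positive =
        let i , low = some-atMost s in i , n≢0⇒n>0 (λ f-i≡0 → f-positive (i , f-i≡0)) , low
      ... | yes (j , f-j≡0) with boundary (λ i → 0 <? f i) (proj₂ (total>0⇒>0 f Σf>0))
                                          (λ f-j>0 → <-irrefl (sym f-j≡0) f-j>0)
      ...   | i , f-i>0 , f-next-i≯0 = i , f-i>0 , ≤-pred (begin
        suc (sv (next i))             ≡⟨ +-comm 1 (sv (next i)) ⟩
        sv (next i) + 1               ≤⟨ +-monoʳ-≤ (sv (next i)) f-i>0 ⟩
        sv (next i) + f i             ≡⟨ flow i ⟩
        tv (next i) + f (next i)      ≡⟨ cong (tv (next i) +_) (n≤0⇒n≡0 (≮⇒≥ f-next-i≯0)) ⟩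
        tv (next i) + 0               ≡⟨ +-identityʳ _ ⟩
        tv (next i)                   ≤⟨ proj₂ (t-balanced (next i)) ⟩
        suc k                         ∎)
        where open ≤-Reasoning

    find-move : (s : Cfg) (f : Fin (suc m) → ℕ) → Flow s t f → 0 < total f →
                ∃ λ i → 0 < f i × proj₁ s (next i) < proj₁ s i
    find-move s f flow Σf>0 with Fin.any? (λ i → (0 <? f i) ×-dec (suc (proj₁ s (next i)) ≤? proj₁ s i))
    ... | yes found = found
    ... | no none   = ⊥-elim (¬owed (proj₁ owed) (proj₂ owed))
      where
      open Stuck s f flow (λ i f-i>0 → ≮⇒≥ (λ lt → none (i , f-i>0 , lt)))
      owed : ∃ Owed
      owed = owed-somewhere Σf>0

    reach-≈ : (s : Cfg) → ∃ λ c → Path s c × c ≈ t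
    reach-≈ s = let f , flow = flow-exists s t in go (total f) s f refl flow
      where
      go : (N : ℕ) (s : Cfg) (f : Fin (suc m) → ℕ) → total f ≡ N → Flow s t f →
           ∃ λ c → Path s c × c ≈ t
      go zero    s f Σf flow = s , ε , flow-done {s = s} {t = t} flow Σf
      go (suc N) s f Σf flow with find-move s f flow (subst (0 <_) (sym Σf) (s≤s z≤n))
      ... | i , f-i>0 , gt with go N (move s i gt) (updateAt f i ℕ.pred)
                                    (suc-injective (trans (total-updateAt-pred f i f-i>0) Σf))
                                    (flow-move {s = s} {t = t} gt flow f-i>0)
      ...   | c , path , c≈t = c , move-arc s i gt ◅ path , c≈t

δ : ℕ → ℕ → ℕ
δ zero    zero    = 1
δ zero    (suc _) = 0
δ (suc _) zero    = 0
δ (suc a) (suc b) = δ a b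

δ-refl : ∀ a → δ a a ≡ 1
δ-refl zero    = refl
δ-refl (suc a) = δ-refl a

δ-≡ : ∀ {a b} → a ≡ b → δ a b ≡ 1
δ-≡ {a} refl = δ-refl a

δ-≢ : ∀ {a b} → a ≢ b → δ a b ≡ 0
δ-≢ {zero}  {zero}  a≢b = ⊥-elim (a≢b refl)
δ-≢ {zero}  {suc b} _   = refl
δ-≢ {suc a} {zero}  _   = refl
δ-≢ {suc a} {suc b} a≢b = δ-≢ (λ e → a≢b (cong suc e))

δ≡1⇒≡ : ∀ {a b} → δ a b ≡ 1 → a ≡ b
δ≡1⇒≡ {zero}  {zero}  _ = refl
δ≡1⇒≡ {suc a} {suc b} e = cong suc (δ≡1⇒≡ e)

infix 4 _<ₗ_
_<ₗ_ : ℕ × ℕ → ℕ × ℕ → Set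
_<ₗ_ = ×-Lex _≡_ _<_ _<_

<ₗ-trans : Transitive _<ₗ_
<ₗ-trans = ×-transitive isEquivalence <-resp₂-≡ <-trans (λ {x y z} → <-trans {x} {y} {z})

<ₗ-irrefl : ∀ {u} → ¬ u <ₗ u
<ₗ-irrefl (inj₁ lt)       = <-irrefl refl lt
<ₗ-irrefl (inj₂ (_ , lt)) = <-irrefl refl lt

open StrictToNonStrict _≡_ _<ₗ_ using () renaming (_≤_ to _≤ₗ_)

≤ₗ-trans : Transitive _≤ₗ_
≤ₗ-trans = StrictToNonStrict.trans _≡_ _<ₗ_ isEquivalence (resp₂ _<ₗ_) <ₗ-trans

≤ₗ-<ₗ-trans : Trans _≤ₗ_ _<ₗ_ _<ₗ_
≤ₗ-<ₗ-trans = StrictToNonStrict.≤-<-trans _≡_ _<ₗ_ sym <ₗ-trans (proj₂ (resp₂ _<ₗ_))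

module NoCycle {m n : ℕ} (low high : ℕ) (wide : 2 + low ≤ high) where
  private
    Cfg : Set
    Cfg = Config (suc m) n
    Pos : Set
    Pos = Fin (suc m)

  Within : Cfg → Set
  Within a = ∀ j → low ≤ proj₁ a j × proj₁ a j ≤ high

  Marked : Pos → Pos → Cfg → Set
  Marked j₀ j₁ a = proj₁ a j₀ ≡ low × proj₁ a j₁ ≡ high

  within-move : ∀ {i} {a b : Cfg} → MoveAt i a b → Within a → Within b
  within-move {i} {a} {b} mv within = within'
    where
    open MoveAt mv
    within' : Within b
    within' j with j Fin.≟ i | j Fin.≟ next i
    ... | yes refl | _ = ≤-pred (subst (low <_) (sym dec) (≤-<-trans (proj₁ (within (next j))) allowed))
                       , ≤-pred (subst (_≤ suc high) (sym dec) (m≤n⇒m≤1+n (proj₂ (within j))))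
    ... | no _ | yes refl = subst (low ≤_) (sym inc) (m≤n⇒m≤1+n (proj₁ (within j)))
                          , subst (_≤ high) (sym inc) (≤-trans allowed (proj₂ (within i)))
    ... | no j≢i | no j≢next-i =
      subst (λ v → low ≤ v × v ≤ high) (sym (others j j≢i j≢next-i)) (within j)

  atLow atHigh : Cfg → Pos → ℕ
  atLow  a j = δ (proj₁ a j) low
  atHigh a j = δ (proj₁ a j) high

  #low #high : Cfg → ℕ
  #low  a = total (atLow a)
  #high a = total (atHigh a)

  toLow : Cfg → Pos → ℕ
  toLow a h = dist h · atLow a

  fromHigh : Cfg → Pos → ℕ
  fromHigh a j = (λ h → dist h j) · atHigh a

  -- Σ of dist h j over high positions h and low positions j: it drops by #low when a high entry
  -- advances and by #high when a low entry retreats.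
  crossing : Cfg → ℕ
  crossing a = toLow a · atHigh a

  crossing-sym : (a : Cfg) → crossing a ≡ fromHigh a · atLow a
  crossing-sym a = begin
    total (λ h → total (λ j → dist h j * atLow a j) * atHigh a h)
      ≡⟨ total-cong (λ h → sym (total-*ʳ (λ j → dist h j * atLow a j) (atHigh a h))) ⟩
    total (λ h → total (λ j → dist h j * atLow a j * atHigh a h))
      ≡⟨ total-comm (λ h j → dist h j * atLow a j * atHigh a h) ⟩
    total (λ j → total (λ h → dist h j * atLow a j * atHigh a h))
      ≡⟨ total-cong (λ j → trans (total-cong (λ h → *-xy∙z≈xz∙y (dist h j) (atLow a j) (atHigh a h)))
                                 (total-*ʳ (λ h → dist h j * atHigh a h) (atLow a j))) ⟩
    total (λ j → total (λ h → dist h j * atHigh a h) * atLow a j) ∎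
    where open ≡-Reasoning

  toLow-next : (a : Cfg) (i : Pos) → atLow a i ≡ 0 → toLow a i ≡ #low a + toLow a (next i)
  toLow-next a i not-low = trans (total-cong termwise) (total-+ (atLow a) (λ j → dist (next i) j * atLow a j))
    where
    termwise : ∀ j → dist i j * atLow a j ≡ atLow a j + dist (next i) j * atLow a j
    termwise j with j Fin.≟ i
    ... | yes refl rewrite not-low = trans (*-zeroʳ (dist j j)) (sym (*-zeroʳ (dist (next j) j)))
    ... | no j≢i = cong (_* atLow a j) (dist-nextˡ i j j≢i)

  fromHigh-next : (a : Cfg) (i : Pos) → atHigh a (next i) ≡ 0 → fromHigh a (next i) ≡ #high a + fromHigh a i
  fromHigh-next a i not-high = trans (total-cong termwise) (total-+ (atHigh a) (λ h → dist h i * atHigh a h))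
    where
    termwise : ∀ h → dist h (next i) * atHigh a h ≡ atHigh a h + dist h i * atHigh a h
    termwise h with h Fin.≟ next i
    ... | yes refl rewrite not-high = trans (*-zeroʳ (dist h h)) (sym (*-zeroʳ (dist h i)))
    ... | no h≢next-i = cong (_* atHigh a h) (dist-nextʳ h i (λ e → h≢next-i (sym e)))

  sumSq : Cfg → ℕ
  sumSq a = proj₁ a · proj₁ a

  potential : Cfg → ℕ × ℕ
  potential a = sumSq a , crossing a

  moment : Pos → Cfg → ℕ
  moment j₀ a = dist j₀ · proj₁ a

  data Step (a b : Cfg) : Set where
    squares-drop  : sumSq b < sumSq a → Step a b
    high-advances : sumSq b ≡ sumSq a → crossing b + #low a ≡ crossing a → Step a b
    low-retreats  : sumSq b ≡ sumSq a → crossing b + #high a ≡ crossing a → Step a b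
    neutral       : sumSq b ≡ sumSq a →
                    (∀ j → atLow b j ≡ atLow a j) → (∀ j → atHigh b j ≡ atHigh a j) →
                    (∀ j₀ → proj₁ a j₀ ≡ low → moment j₀ b ≡ suc (moment j₀ a)) → Step a b

  private
    transfer-·-shift : ∀ {i i'} {u u' : Pos → ℕ} → Transfer i i' u u' →
                       (w : Pos → ℕ) {c : ℕ} → w i ≡ c + w i' → w · u' + c ≡ w · u
    transfer-·-shift {i} {i'} {u} {u'} t w {c} w-i = +-cancelʳ-≡ (w i') _ _ (begin
      w · u' + c + w i'     ≡⟨ +-assoc (w · u') c (w i') ⟩
      w · u' + (c + w i')   ≡⟨ cong (w · u' +_) (sym w-i) ⟩
      w · u' + w i          ≡⟨ transfer-· t w ⟩
      w · u + w i'          ∎)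
      where open ≡-Reasoning

    squares-fall : ∀ {i} {a b : Cfg} → MoveAt i a b → proj₁ b i ≢ proj₁ a (next i) → sumSq b < sumSq a
    squares-fall {i} {a} {b} mv not-swap =
      +-cancelʳ-< (2 * proj₁ b i) (sumSq b) (sumSq a) (begin-strict
        sumSq b + 2 * proj₁ b i         ≡⟨ transfer-sumSq (move⇒transfer mv) ⟩
        sumSq a + 2 * proj₁ a (next i)  <⟨ +-monoʳ-< (sumSq a) (*-monoʳ-< 2 y<b-i) ⟩
        sumSq a + 2 * proj₁ b i         ∎)
      where
      open ≤-Reasoning
      open MoveAt mv
      y<b-i : proj₁ a (next i) < proj₁ b i
      y<b-i = ≤∧≢⇒< (≤-pred (subst (proj₁ a (next i) <_) (sym dec) allowed)) (λ e → not-swap (sym e))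

    swap-step : ∀ {i} {a b : Cfg} → MoveAt i a b → Within a → proj₁ b i ≡ proj₁ a (next i) → Step a b
    swap-step {i} {a} {b} mv within swap = classify (x ≟ high) (y ≟ low)
      where
      open MoveAt mv
      open ≡-Reasoning
      x y : ℕ
      x = proj₁ a i
      y = proj₁ a (next i)
      exch : Exchange i (next i) (proj₁ a) (proj₁ b)
      exch = swap⇒exchange mv swap
      x≡1+y : x ≡ suc y
      x≡1+y = trans (sym dec) (cong suc swap)
      x≢low : x ≢ low
      x≢low x≡low = <⇒≢ (≤-<-trans (proj₁ (within (next i))) allowed) (sym x≡low)
      y≢high : y ≢ high
      y≢high = <⇒≢ (<-≤-trans allowed (proj₂ (within i)))
      squares-same : sumSq b ≡ sumSq a
      squares-same = +-cancelʳ-≡ (2 * y) _ _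
        (trans (cong (λ v → sumSq b + 2 * v) (sym swap)) (transfer-sumSq (move⇒transfer mv)))
      fixes : (φ : ℕ → ℕ) → φ x ≡ φ y → ∀ j → φ (proj₁ b j) ≡ φ (proj₁ a j)
      fixes φ = exchange-fixes (exchange-map exch φ)

      classify : Dec (x ≡ high) → Dec (y ≡ low) → Step a b
      classify (yes x≡high) _ = high-advances squares-same (begin
        crossing b + #low a           ≡⟨ cong (_+ #low a) (total-cong λ h →
                                           cong (_* atHigh b h) (total-cong λ j → cong (dist h j *_) (low-fixed j))) ⟩
        toLow a · atHigh b + #low a   ≡⟨ transfer-·-shift high-moves (toLow a) (toLow-next a i (δ-≢ x≢low)) ⟩
        crossing a                    ∎)
        where
        y≢low : y ≢ low
        y≢low y≡low = <⇒≢ wide (sym (trans (sym x≡high) (trans x≡1+y (cong suc y≡low))))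
        low-fixed : ∀ j → atLow b j ≡ atLow a j
        low-fixed = fixes (λ v → δ v low) (trans (δ-≢ x≢low) (sym (δ-≢ y≢low)))
        high-moves : Transfer i (next i) (atHigh a) (atHigh b)
        high-moves = exchange-transfer (exchange-map exch (λ v → δ v high))
                                       (δ-≡ x≡high) (δ-≢ y≢high)
      classify (no x≢high) (yes y≡low) = low-retreats squares-same (begin
        crossing b + #high a           ≡⟨ cong (_+ #high a) (crossing-sym b) ⟩
        fromHigh b · atLow b + #high a ≡⟨ cong (_+ #high a) (total-cong λ j →
                                            cong (_* atLow b j) (total-cong λ h → cong (dist h j *_) (high-fixed h))) ⟩
        fromHigh a · atLow b + #high a ≡⟨ transfer-·-shift low-moves (fromHigh a) (fromHigh-next a i (δ-≢ y≢high)) ⟩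
        fromHigh a · atLow a           ≡⟨ sym (crossing-sym a) ⟩
        crossing a                     ∎)
        where
        high-fixed : ∀ j → atHigh b j ≡ atHigh a j
        high-fixed = fixes (λ v → δ v high) (trans (δ-≢ x≢high) (sym (δ-≢ y≢high)))
        low-moves : Transfer (next i) i (atLow a) (atLow b)
        low-moves = exchange-transfer (exchange-sym (exchange-map exch (λ v → δ v low)))
                                      (δ-≡ y≡low) (δ-≢ x≢low)
      classify (no x≢high) (no y≢low) =
        neutral squares-same (fixes (λ v → δ v low) (trans (δ-≢ x≢low) (sym (δ-≢ y≢low))))
                             (fixes (λ v → δ v high) (trans (δ-≢ x≢high) (sym (δ-≢ y≢high))))
                             moment-grows
        where
        moment-grows : ∀ j₀ → proj₁ a j₀ ≡ low → moment j₀ b ≡ suc (moment j₀ a)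
        moment-grows j₀ a-j₀≡low = +-cancelʳ-≡ (dist j₀ i) _ _ (begin
          moment j₀ b + dist j₀ i           ≡⟨ transfer-· (move⇒transfer mv) (dist j₀) ⟩
          moment j₀ a + dist j₀ (next i)    ≡⟨ cong (moment j₀ a +_) (dist-nextʳ j₀ i next-i≢j₀) ⟩
          moment j₀ a + suc (dist j₀ i)     ≡⟨ +-suc (moment j₀ a) (dist j₀ i) ⟩
          suc (moment j₀ a) + dist j₀ i     ∎)
          where
          next-i≢j₀ : next i ≢ j₀
          next-i≢j₀ e = y≢low (trans (cong (proj₁ a) e) a-j₀≡low)

  step : ∀ {i} {a b : Cfg} → MoveAt i a b → Within a → Step a b
  step {i} {a} {b} mv within with proj₁ b i ≟ proj₁ a (next i)
  ... | no  not-swap = squares-drop (squares-fall mv not-swap)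
  ... | yes swap     = swap-step mv within swap

  private
    +-pos⇒< : ∀ {u c v} → u + c ≡ v → 0 < c → u < v
    +-pos⇒< {u} u+c≡v c>0 = subst (u <_) u+c≡v (m<m+n u c>0)

    level-or-lower : ∀ {s s' u v c} → s' ≡ s → u + c ≡ v → (s' , u) ≤ₗ (s , v)
    level-or-lower {c = zero}  s'≡s u+0≡v = inj₂ (cong₂ _,_ s'≡s (trans (sym (+-identityʳ _)) u+0≡v))
    level-or-lower {c = suc c} s'≡s u+c≡v = inj₁ (inj₂ (s'≡s , +-pos⇒< u+c≡v (s≤s z≤n)))

    occupied : (a : Cfg) {v : ℕ} (j : Pos) → proj₁ a j ≡ v → 0 < total (λ j → δ (proj₁ a j) v)
    occupied a {v} j a-j≡v =
      ≤-trans (≤-reflexive (sym (δ-≡ a-j≡v))) (term≤total (λ j → δ (proj₁ a j) v) j)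

    neutral-crossing : ∀ {a b} → (∀ j → atLow b j ≡ atLow a j) → (∀ j → atHigh b j ≡ atHigh a j) →
                       crossing b ≡ crossing a
    neutral-crossing low-fixed high-fixed = total-cong λ h →
      cong₂ _*_ (total-cong λ j → cong (dist h j *_) (low-fixed j)) (high-fixed h)

  step-≤ₗ : ∀ {a b} → Step a b → potential b ≤ₗ potential a
  step-≤ₗ (squares-drop lt)              = inj₁ (inj₁ lt)
  step-≤ₗ (high-advances same crossing≡) = level-or-lower same crossing≡
  step-≤ₗ (low-retreats same crossing≡)  = level-or-lower same crossing≡
  step-≤ₗ {a} {b} (neutral same low-fixed high-fixed _) =
    inj₂ (cong₂ _,_ same (neutral-crossing {a} {b} low-fixed high-fixed))

  step-marked : ∀ {j₀ j₁} {a b} → Marked j₀ j₁ a → Step a b →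
                potential b <ₗ potential a ⊎
                (potential b ≡ potential a × Marked j₀ j₁ b × moment j₀ b ≡ suc (moment j₀ a))
  step-marked _ (squares-drop lt) = inj₁ (inj₁ lt)
  step-marked {j₀} {a = a} (a-j₀ , _) (high-advances same crossing≡) =
    inj₁ (inj₂ (same , +-pos⇒< crossing≡ (occupied a j₀ a-j₀)))
  step-marked {j₁ = j₁} {a = a} (_ , a-j₁) (low-retreats same crossing≡) =
    inj₁ (inj₂ (same , +-pos⇒< crossing≡ (occupied a j₁ a-j₁)))
  step-marked {j₀} {j₁} {a} {b} (a-j₀ , a-j₁) (neutral same low-fixed high-fixed grows) =
    inj₂ ( cong₂ _,_ same (neutral-crossing {a} {b} low-fixed high-fixed)
         , (δ≡1⇒≡ (trans (low-fixed j₀) (δ-≡ a-j₀)) , δ≡1⇒≡ (trans (high-fixed j₁) (δ-≡ a-j₁)))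
         , grows j₀ a-j₀ )

  descend : ∀ {a b} → Star _⟶_ a b → Within a → potential b ≤ₗ potential a
  descend ε                  _      = inj₂ refl
  descend ((_ , mv) ◅ path) within =
    ≤ₗ-trans (descend path (within-move mv within)) (step-≤ₗ (step mv within))

  moment-grows : ∀ {j₀ j₁} {a z b} → a ⟶ z → Star _⟶_ z b → Within a → Marked j₀ j₁ a →
                 potential a ≤ₗ potential b → moment j₀ a < moment j₀ b
  moment-grows {b = b} (_ , mv) path within marked a≤b with step-marked marked (step mv within)
  ... | inj₁ drop =
    ⊥-elim (<ₗ-irrefl (≤ₗ-<ₗ-trans a≤b (≤ₗ-<ₗ-trans (descend path (within-move mv within)) drop)))
  ... | inj₂ (level , marked' , grows) with path
  ...   | ε             = ≤-reflexive (sym grows)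
  ...   | arc ◅ path'   = <-trans (≤-reflexive (sym grows))
                                  (moment-grows arc path' (within-move mv within) marked'
                                                (subst (_≤ₗ potential b) (sym level) a≤b))

  ¬dual : ∀ {j₀ j₁} {a} → Within a → Marked j₀ j₁ a → ¬ Dual a
  ¬dual within marked cycle = let _ , arc , rest = uncons cycle in
    <-irrefl refl (moment-grows arc rest within marked (inj₂ refl))

argmax : ∀ {p} (f : Fin (suc p) → ℕ) → ∃ λ j → ∀ i → f i ≤ f j
argmax {zero}  f = zero , λ { zero → ≤-refl }
argmax {suc p} f with argmax (λ i → f (suc i))
... | j , max with f zero ≤? f (suc j)
...   | yes f0≤ = suc j , λ { zero → f0≤ ; (suc i) → max i }
...   | no  f0≰ = zero , λ { zero → ≤-refl ; (suc i) → ≤-trans (max i) (<⇒≤ (≰⇒> f0≰)) }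

argmin : ∀ {p} (f : Fin (suc p) → ℕ) → ∃ λ j → ∀ i → f j ≤ f i
argmin {zero}  f = zero , λ { zero → ≤-refl }
argmin {suc p} f with argmin (λ i → f (suc i))
... | j , min with f (suc j) ≤? f zero
...   | yes ≤f0 = suc j , λ { zero → ≤f0 ; (suc i) → min i }
...   | no  ≰f0 = zero , λ { zero → ≤-refl ; (suc i) → ≤-trans (<⇒≤ (≰⇒> ≰f0)) (min i) }

module _ {m n : ℕ} where
  private
    Cfg : Set
    Cfg = Config (suc m) n

  dual-spread : (b : Cfg) → Dual b → ∀ i j → proj₁ b i ≤ suc (proj₁ b j)
  dual-spread b dual i j with argmax (proj₁ b) | argmin (proj₁ b)
  ... | jM , max | jm , min with 2 + proj₁ b jm ≤? proj₁ b jM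
  ...   | yes wide  =
    ⊥-elim (NoCycle.¬dual (proj₁ b jm) (proj₁ b jM) wide (λ j → min j , max j) (refl , refl) dual)
  ...   | no narrow = ≤-trans (max i) (≤-trans (≤-pred (≰⇒> narrow)) (s≤s (min j)))

  spread≤1⇒balanced : ∀ {k} → suc m * k < n → n < suc m * suc k → (b : Cfg) →
                      (∀ i j → proj₁ b i ≤ suc (proj₁ b j)) → ∀ j → k ≤ proj₁ b j × proj₁ b j ≤ suc k
  spread≤1⇒balanced above below (b , Σb) spread j =
      ≮⇒≥ (λ b-j<k → <-irrefl Σb (≤-<-trans (total-≤ λ i → ≤-trans (spread i j) b-j<k) above))
    , ≮⇒≥ (λ k+1<b-j →
        <-irrefl (sym Σb) (<-≤-trans below (total-≥ λ i → ≤-pred (≤-trans k+1<b-j (spread j i)))))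

quotient-bounds : ∀ m n → n % suc m > 0 → suc m * (n / suc m) < n × n < suc m * suc (n / suc m)
quotient-bounds m n r>0 = above , below
  where
  open ≤-Reasoning
  k r : ℕ
  k = n / suc m
  r = n % suc m
  n≡r+k*p : n ≡ r + k * suc m
  n≡r+k*p = m≡m%n+[m/n]*n n (suc m)
  above : suc m * k < n
  above = begin-strict
    suc m * k      ≡⟨ *-comm (suc m) k ⟩
    k * suc m      <⟨ m<n+m (k * suc m) r>0 ⟩
    r + k * suc m  ≡⟨ sym n≡r+k*p ⟩
    n              ∎
  below : n < suc m * suc k
  below = begin-strict
    n              ≡⟨ n≡r+k*p ⟩
    r + k * suc m  <⟨ +-monoˡ-< (k * suc m) (m%n<n n (suc m)) ⟩
    suc k * suc m  ≡⟨ *-comm (suc k) (suc m) ⟩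
    suc m * suc k  ∎

corollary2 : (m n : ℕ) → n % suc m > 0 →
    (a b : Config (suc m) n) → Dual b → Path a b
corollary2 m n r>0 a b dual =
  let above , below     = quotient-bounds m n r>0
      c , a⇝c , c≈b     = Balanced.reach-≈ above below b
                            (spread≤1⇒balanced above below b (dual-spread b dual)) a
      _ , b⟶b' , b'⇝b   = uncons dual
  in a⇝c ◅◅ ⟶-respˡ-≈ (λ j → sym (c≈b j)) b⟶b' ◅ b'⇝b
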